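{- Let $n\ge1$, let $V$ be any $\mathbb{F}_2$-vector space, and let $F$ be a linear subspace of $V\otimes\mathbb{F}_2^n$ such that $(\mathrm{Id}\otimes J_n)(F)\subseteq F$ and $F\subseteq\ker(\mathrm{Id}\otimes c)$. Then $(\mathrm{Id}\otimes S)(F)=\{0\}$ in $V\otimes\mathbb{F}_2^{\lceil n/2\rceil}$.
   Context: $J_n$ is the $n\times n$ matrix over $\mathbb{F}_2$ with $1$'s directly above and below the diagonal and $0$'s elsewhere. $c:\mathbb{F}_2^n\to\mathbb{F}_2$ is $c(y_1,\dots,y_n)=\sum_{i=1}^ny_i$. $S:\mathbb{F}_2^n\to\mathbb{F}_2^{\lceil n/2\rceil}$ is defined by $S(y)=(y_1+y_n,y_2+y_{n-1},\dots,y_{n/2}+y_{n/2+1})$ if $n$ is even, and $S(y)=(y_1+y_n,\dots,y_{\lceil n/2\rceil-1}+y_{\lceil n/2\rceil+1},y_{\lceil n/2\rceil})$ if $n$ is odd. -}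

module Defs where

open import Level using (Level; _⊔_)
open import Data.Nat using (ℕ; zero; suc; _+_; _*_; _∸_; _<?_; ⌈_/2⌉; _≟_)
open import Data.Fin using (Fin; toℕ; fromℕ<)
open import Data.Bool.Properties using (xor-∧-commutativeRing)
open import Algebra.Bundles using (CommutativeRing)
open import Algebra.Module.Bundles using (Module)
open import Relation.Nullary using (yes; no)

𝔽₂ : CommutativeRing Level.zero Level.zero
𝔽₂ = xor-∧-commutativeRing

-- V ⊗ F₂ⁿ is identified with Vⁿ = Fin n → V (coordinates y₁ … yₙ,
-- stored 0-based).
module _ {m ℓm : Level} (V : Module 𝔽₂ m ℓm) where
  open Module V

  Tensor : ℕ → Set m
  Tensor n = Fin n → Carrierᴹ

  at : {n : ℕ} → Tensor n → ℕ → Carrierᴹ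
  at {n} y k with k <? n
  ... | yes p = y (fromℕ< p)
  ... | no _  = 0ᴹ

  -- 1-based access: y_k for 1 ≤ k ≤ n, 0ᴹ otherwise (y_0 = y_{n+1} = 0)
  at₁ : {n : ℕ} → Tensor n → ℕ → Carrierᴹ
  at₁ y zero    = 0ᴹ
  at₁ y (suc k) = at y k

  IdJ : {n : ℕ} → Tensor n → Tensor n
  IdJ y i = at₁ y (toℕ i) +ᴹ at₁ y (suc (suc (toℕ i)))

  Idc : {n : ℕ} → Tensor n → Carrierᴹ
  Idc {zero}  y = 0ᴹ
  Idc {suc n} y = y Fin.zero +ᴹ Idc (λ i → y (Fin.suc i))

  IdS : {n : ℕ} → Tensor n → Tensor ⌈ n /2⌉
  IdS {n} y j with suc (2 * toℕ j) ≟ n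
  ... | yes _ = at y (toℕ j)
  ... | no _  = at y (toℕ j) +ᴹ at y (n ∸ 1 ∸ toℕ j)

  record IsSubspace {p : Level} (n : ℕ) (F : Tensor n → Set p)
         : Set (m ⊔ ℓm ⊔ p) where
    field
      respects : ∀ x y → (∀ i → x i ≈ᴹ y i) → F x → F y
      has-zero : F (λ _ → 0ᴹ)
      closed-+ : ∀ x y → F x → F y → F (λ i → x i +ᴹ y i)
      closed-* : ∀ (r : CommutativeRing.Carrier 𝔽₂) x → F x → F (λ i → r *ₗ x i)

-- Write Y₀ = Y_{n+1} = 0 and Y₁, …, Yₙ for the coordinates of y, and call
-- i + j = n + 1 a mirror pair.  The coordinates of Jy telescope,
-- c(Jy) = Y₁ + Yₙ, so Y₁ + Yₙ vanishes on F.  Since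
-- (Jy)_{i+1} + (Jy)_{j+1} = (Y_i + Y_{j+2}) + (Y_{i+2} + Y_j),
-- induction on i shows that every mirror sum Y_i + Y_j vanishes on F.
-- These are the components of S y; for odd n the middle component is c(y),
-- because all other coordinates cancel in mirror pairs.
module Submission where

open import Defs
open import Level using (Level)
open import Data.Nat using (ℕ; zero; suc; _+_; _*_; _∸_; _≤_; _<_; _<?_; _≤?_; _≟_; ⌈_/2⌉; z<s; s<s; s≤s; s≤s⁻¹)
open import Data.Nat.Properties
  using (≤-refl; ≤-trans; ≰⇒>; <⇒≱; +-suc; +-identityʳ; m≤m+n; m≤n+m; ∸-+-assoc; m+[n∸m]≡n; ⌈n/2⌉≤n)
open import Data.Fin using (Fin; toℕ; fromℕ<)
open import Data.Fin.Properties using (toℕ-fromℕ<; toℕ<n)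
open import Data.Bool using (true; false)
open import Function using (_∘_)
open import Algebra.Module.Bundles using (Module)
open import Relation.Nullary using (yes; no; contradiction)
open import Relation.Binary.PropositionalEquality using (_≡_; refl; sym; trans; cong; cong₂; subst)

module _ {m ℓm : Level} (V : Module 𝔽₂ m ℓm) where
  open Module V
  open import Relation.Binary.Reasoning.Setoid ≈ᴹ-setoid
  open import Algebra.Solver.CommutativeMonoid +ᴹ-commutativeMonoid using (solve; _⊜_; _⊕_)

  x+x≈0 : ∀ x → x +ᴹ x ≈ᴹ 0ᴹ
  x+x≈0 x = begin
    x +ᴹ x                  ≈⟨ +ᴹ-cong (*ₗ-identityˡ x) (*ₗ-identityˡ x) ⟨
    true *ₗ x +ᴹ true *ₗ x  ≈⟨ *ₗ-distribʳ x true true ⟨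
    false *ₗ x              ≈⟨ *ₗ-zeroˡ x ⟩
    0ᴹ                      ∎

  x+[y+y]≈x : ∀ x y → x +ᴹ (y +ᴹ y) ≈ᴹ x
  x+[y+y]≈x x y = ≈ᴹ-trans (+ᴹ-cong ≈ᴹ-refl (x+x≈0 y)) (+ᴹ-identityʳ x)

  sum : (ℕ → Carrierᴹ) → ℕ → Carrierᴹ
  sum f zero    = 0ᴹ
  sum f (suc l) = f 0 +ᴹ sum (f ∘ suc) l

  sum-cong : ∀ {f g} l → (∀ i → i < l → f i ≈ᴹ g i) → sum f l ≈ᴹ sum g l
  sum-cong zero    f≈g = ≈ᴹ-refl
  sum-cong (suc l) f≈g = +ᴹ-cong (f≈g 0 z<s) (sum-cong l (λ i i<l → f≈g (suc i) (s<s i<l)))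

  sum-snoc : ∀ f l → sum f (suc l) ≈ᴹ sum f l +ᴹ f l
  sum-snoc f zero    = +ᴹ-comm (f 0) 0ᴹ
  sum-snoc f (suc l) = begin
    f 0 +ᴹ sum (f ∘ suc) (suc l)             ≈⟨ +ᴹ-cong ≈ᴹ-refl (sum-snoc (f ∘ suc) l) ⟩
    f 0 +ᴹ (sum (f ∘ suc) l +ᴹ f (suc l))   ≈⟨ +ᴹ-assoc (f 0) _ _ ⟨
    sum f (suc l) +ᴹ f (suc l)               ∎

  sum-telescope : ∀ g l → sum (λ i → g i +ᴹ g (suc (suc i))) l ≈ᴹ (g 0 +ᴹ g 1) +ᴹ (g l +ᴹ g (suc l))
  sum-telescope g zero    = ≈ᴹ-sym (x+x≈0 _)
  sum-telescope g (suc l) = begin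
    (g 0 +ᴹ g 2) +ᴹ sum (λ i → g (suc i) +ᴹ g (3 + i)) l
      ≈⟨ +ᴹ-cong ≈ᴹ-refl (sum-telescope (g ∘ suc) l) ⟩
    (g 0 +ᴹ g 2) +ᴹ ((g 1 +ᴹ g 2) +ᴹ (g (suc l) +ᴹ g (2 + l)))
      ≈⟨ solve 5 (λ a b c d e → (a ⊕ c) ⊕ ((b ⊕ c) ⊕ (d ⊕ e)) ⊜ ((a ⊕ b) ⊕ (d ⊕ e)) ⊕ (c ⊕ c))
               ≈ᴹ-refl (g 0) (g 1) (g 2) (g (suc l)) (g (2 + l)) ⟩
    ((g 0 +ᴹ g 1) +ᴹ (g (suc l) +ᴹ g (2 + l))) +ᴹ (g 2 +ᴹ g 2)
      ≈⟨ x+[y+y]≈x _ (g 2) ⟩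
    (g 0 +ᴹ g 1) +ᴹ (g (suc l) +ᴹ g (2 + l)) ∎

  sum-palindrome≈middle : ∀ f k → (∀ i j → i + j ≡ k + k → f i +ᴹ f j ≈ᴹ 0ᴹ) → sum f (suc (k + k)) ≈ᴹ f k
  sum-palindrome≈middle f zero    _   = +ᴹ-identityʳ (f 0)
  sum-palindrome≈middle f (suc k) pal = begin
    f 0 +ᴹ sum (f ∘ suc) (suc (k + suc k))            ≡⟨ cong (λ l → f 0 +ᴹ sum (f ∘ suc) (suc l)) (+-suc k k) ⟩
    f 0 +ᴹ sum (f ∘ suc) (2 + (k + k))                ≈⟨ +ᴹ-cong ≈ᴹ-refl (sum-snoc (f ∘ suc) (suc (k + k))) ⟩
    f 0 +ᴹ (sum (f ∘ suc) (suc (k + k)) +ᴹ f (2 + (k + k)))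
      ≈⟨ +ᴹ-cong ≈ᴹ-refl (+ᴹ-cong (sum-palindrome≈middle (f ∘ suc) k inner) ≈ᴹ-refl) ⟩
    f 0 +ᴹ (f (suc k) +ᴹ f (2 + (k + k)))              ≈⟨ solve 3 (λ a b c → a ⊕ (b ⊕ c) ⊜ b ⊕ (a ⊕ c)) ≈ᴹ-refl _ _ _ ⟩
    f (suc k) +ᴹ (f 0 +ᴹ f (2 + (k + k)))              ≈⟨ +ᴹ-cong ≈ᴹ-refl (pal 0 _ (cong suc (sym (+-suc k k)))) ⟩
    f (suc k) +ᴹ 0ᴹ                                    ≈⟨ +ᴹ-identityʳ _ ⟩
    f (suc k)                                          ∎
    where
    inner : ∀ i j → i + j ≡ k + k → f (suc i) +ᴹ f (suc j) ≈ᴹ 0ᴹ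
    inner i j i+j≡k+k = pal (suc i) (suc j) (cong suc (trans (+-suc i j) (trans (cong suc i+j≡k+k) (sym (+-suc k k)))))

  at-fromℕ< : ∀ {n} (y : Tensor V n) {k} (k<n : k < n) → at V y k ≡ y (fromℕ< k<n)
  at-fromℕ< {n} y {k} k<n with k <? n
  ... | yes _   = refl
  ... | no  k≮n = contradiction k<n k≮n

  at-≥ : ∀ {n} (y : Tensor V n) {k} → n ≤ k → at V y k ≡ 0ᴹ
  at-≥ {n} y {k} n≤k with k <? n
  ... | yes k<n = contradiction n≤k (<⇒≱ k<n)
  ... | no  _   = refl

  at-suc : ∀ {n} (y : Tensor V (suc n)) k → at V y (suc k) ≡ at V (y ∘ Fin.suc) k
  at-suc {n} y k with n ≤? k
  ... | yes n≤k = trans (at-≥ y (s≤s n≤k)) (sym (at-≥ (y ∘ Fin.suc) n≤k))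
  ... | no  n≰k = trans (at-fromℕ< y (s<s (≰⇒> n≰k))) (sym (at-fromℕ< (y ∘ Fin.suc) (≰⇒> n≰k)))

  Idc≈sum-at : ∀ {n} (y : Tensor V n) → Idc V y ≈ᴹ sum (at V y) n
  Idc≈sum-at {zero}  y = ≈ᴹ-refl
  Idc≈sum-at {suc n} y = +ᴹ-cong (≈ᴹ-reflexive (sym (at-fromℕ< y z<s)))
    (≈ᴹ-trans (Idc≈sum-at (y ∘ Fin.suc)) (sum-cong n (λ i _ → ≈ᴹ-reflexive (sym (at-suc y i)))))

  at₁-IdJ : ∀ {n} (y : Tensor V n) {i} → i < n → at₁ V (IdJ V y) (suc i) ≡ at₁ V y i +ᴹ at₁ V y (2 + i)
  at₁-IdJ y i<n = trans (at-fromℕ< (IdJ V y) i<n) (cong (λ t → at₁ V y t +ᴹ at₁ V y (2 + t)) (toℕ-fromℕ< i<n))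

  Idc-IdJ : ∀ {n} (y : Tensor V n) → Idc V (IdJ V y) ≈ᴹ at₁ V y 1 +ᴹ at₁ V y n
  Idc-IdJ {n} y = begin
    Idc V (IdJ V y)                         ≈⟨ Idc≈sum-at (IdJ V y) ⟩
    sum (at V (IdJ V y)) n                  ≈⟨ sum-cong n (λ i i<n → ≈ᴹ-reflexive (at₁-IdJ y i<n)) ⟩
    sum (λ i → Y i +ᴹ Y (2 + i)) n          ≈⟨ sum-telescope Y n ⟩
    (0ᴹ +ᴹ Y 1) +ᴹ (Y n +ᴹ at V y n)        ≈⟨ +ᴹ-cong (+ᴹ-identityˡ _) (+ᴹ-cong ≈ᴹ-refl (≈ᴹ-reflexive (at-≥ y ≤-refl))) ⟩
    Y 1 +ᴹ (Y n +ᴹ 0ᴹ)                      ≈⟨ +ᴹ-cong ≈ᴹ-refl (+ᴹ-identityʳ _) ⟩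
    Y 1 +ᴹ Y n                              ∎
    where
    Y = at₁ V y

  module _ {p : Level} {n : ℕ} {F : Tensor V n → Set p}
           (IdJ-closed : ∀ y → F y → F (IdJ V y))
           (Idc-vanishes : ∀ y → F y → Idc V y ≈ᴹ 0ᴹ) where

    mirror-sum-vanishes : ∀ i j → i + j ≡ suc n → ∀ y → F y → at₁ V y i +ᴹ at₁ V y j ≈ᴹ 0ᴹ
    mirror-sum-vanishes zero       _ refl y _  = ≈ᴹ-trans (+ᴹ-identityˡ _) (≈ᴹ-reflexive (at-≥ y ≤-refl))
    mirror-sum-vanishes (suc zero) _ refl y Fy = ≈ᴹ-trans (≈ᴹ-sym (Idc-IdJ y)) (Idc-vanishes _ (IdJ-closed y Fy))
    mirror-sum-vanishes (suc (suc i)) j i+j≡ y Fy = begin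
      Y (2 + i) +ᴹ Y j
        ≈⟨ x+[y+y]≈x _ (Y (2 + j)) ⟨
      (Y (2 + i) +ᴹ Y j) +ᴹ (Y (2 + j) +ᴹ Y (2 + j))
        ≈⟨ x+[y+y]≈x _ (Y i) ⟨
      ((Y (2 + i) +ᴹ Y j) +ᴹ (Y (2 + j) +ᴹ Y (2 + j))) +ᴹ (Y i +ᴹ Y i)
        ≈⟨ solve 4 (λ a b c d → ((b ⊕ c) ⊕ (d ⊕ d)) ⊕ (a ⊕ a) ⊜ ((a ⊕ b) ⊕ (c ⊕ d)) ⊕ (a ⊕ d))
                 ≈ᴹ-refl (Y i) (Y (2 + i)) (Y j) (Y (2 + j)) ⟩
      ((Y i +ᴹ Y (2 + i)) +ᴹ (Y j +ᴹ Y (2 + j))) +ᴹ (Y i +ᴹ Y (2 + j))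
        ≡⟨ cong (_+ᴹ (Y i +ᴹ Y (2 + j))) (sym (cong₂ _+ᴹ_ (at₁-IdJ y i<n) (at₁-IdJ y j<n))) ⟩
      (at₁ V (IdJ V y) (suc i) +ᴹ at₁ V (IdJ V y) (suc j)) +ᴹ (Y i +ᴹ Y (2 + j))
        ≈⟨ +ᴹ-cong (mirror-sum-vanishes (suc i) (suc j) inner (IdJ V y) (IdJ-closed y Fy))
                   (mirror-sum-vanishes i (2 + j) outer y Fy) ⟩
      0ᴹ +ᴹ 0ᴹ
        ≈⟨ +ᴹ-identityʳ 0ᴹ ⟩
      0ᴹ ∎
      where
      Y = at₁ V y
      inner : suc i + suc j ≡ suc n
      inner = trans (cong suc (+-suc i j)) i+j≡
      outer : i + (2 + j) ≡ suc n
      outer = trans (+-suc i (suc j)) inner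
      i<n : i < n
      i<n = s≤s⁻¹ (subst (2 + i ≤_) i+j≡ (m≤m+n (2 + i) j))
      j<n : j < n
      j<n = s≤s⁻¹ (subst (2 + j ≤_) outer (m≤n+m (2 + j) i))

    pair-sum-vanishes : ∀ i j → suc (i + j) ≡ n → ∀ y → F y → at V y i +ᴹ at V y j ≈ᴹ 0ᴹ
    pair-sum-vanishes i j i+j+1≡n = mirror-sum-vanishes (suc i) (suc j) (cong suc (trans (+-suc i j) i+j+1≡n))

    IdS-vanishes : ∀ y → F y → ∀ j → IdS V y j ≈ᴹ 0ᴹ
    IdS-vanishes y Fy j with suc (2 * toℕ j) ≟ n
    ... | yes 2j+1≡n = begin
      at V y (toℕ j)                    ≈⟨ sum-palindrome≈middle (at V y) (toℕ j) pal ⟨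
      sum (at V y) (suc (toℕ j + toℕ j)) ≡⟨ cong (sum (at V y)) n≡ ⟩
      sum (at V y) n                    ≈⟨ Idc≈sum-at y ⟨
      Idc V y                           ≈⟨ Idc-vanishes y Fy ⟩
      0ᴹ                                ∎
      where
      n≡ : suc (toℕ j + toℕ j) ≡ n
      n≡ = trans (cong (λ t → suc (toℕ j + t)) (sym (+-identityʳ (toℕ j)))) 2j+1≡n
      pal : ∀ a b → a + b ≡ toℕ j + toℕ j → at V y a +ᴹ at V y b ≈ᴹ 0ᴹ
      pal a b a+b≡ = pair-sum-vanishes a b (trans (cong suc a+b≡) n≡) y Fy
    ... | no _ = pair-sum-vanishes (toℕ j) (n ∸ 1 ∸ toℕ j) mirror y Fy
      where
      j<n : toℕ j < n
      j<n = ≤-trans (toℕ<n j) (⌈n/2⌉≤n n)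
      mirror : suc (toℕ j + (n ∸ 1 ∸ toℕ j)) ≡ n
      mirror = trans (cong (suc (toℕ j) +_) (∸-+-assoc n 1 (toℕ j))) (m+[n∸m]≡n j<n)

lemma8 : {m ℓm p : Level} (n : ℕ) → 1 ≤ n → (V : Module 𝔽₂ m ℓm) →
         (F : Tensor V n → Set p) → IsSubspace V n F →
         (∀ y → F y → F (IdJ V y)) →
         (∀ y → F y → Module._≈ᴹ_ V (Idc V y) (Module.0ᴹ V)) →
         ∀ y → F y → ∀ (j : Fin ⌈ n /2⌉) → Module._≈ᴹ_ V (IdS V y j) (Module.0ᴹ V)
lemma8 n _ V F _ = IdS-vanishes V
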